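{- Let $\mathbb P\subseteq\mathbf{LT}$ be a large-tree forcing notion and $n<\omega$. Then: (i) if $T\in\mathbf{LT}$ and $s_0\in 2^n$, then $T(\to s_0)\in\mathbb P$ iff $T\in\mathbf{LC}_n(\mathbb P)$; (ii) if $P\in\mathbf{LC}_n(\mathbb P)$, $s_0\in 2^n$, $S\in\mathbb P$ and $S\subseteq P(\to s_0)$, then there is $Q\in\mathbf{LC}_n(\mathbb P)$ with $Q\subseteq_n P$ and $Q(\to s_0)=S$; (iii) if $P\in\mathbf{LC}_n(\mathbb P)$ and $D\subseteq\mathbb P$ is open dense in $\mathbb P$, then there is $Q\in\mathbf{LC}_n(\mathbb P)$ with $Q\subseteq_n P$ and $Q(\to s)\in D$ for all $s\in 2^n$; (iv) if $P\in\mathbf{LC}_n(\mathbb P)$, $S,T\in\mathbb P$, $s,t\in 2^n$, $S\subseteq P(\to s^\frown0)$, $T\subseteq P(\to t^\frown 1)$, $\sigma\in 2^{<\omega}$ and $T=\sigma\cdot S$, then there is $Q\in\mathbf{LC}_{n+1}(\mathbb P)$ with $Q\subseteq_{n+1}P$, $Q(\to s^\frown0)\subseteq S$ and $Q(\to t^\frown1)\subseteq T$.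
   Context: For $s,t\in 2^{<\omega}$ with $\mathrm{lh}(s)\le\mathrm{lh}(t)$, $s\cdot t$ has length $\mathrm{lh}(t)$ with $(s\cdot t)(k)=t(k)+s(k)\bmod2$ for $k<\mathrm{lh}(s)$, $=t(k)$ otherwise; if $\mathrm{lh}(s)>\mathrm{lh}(t)$, $s\cdot t=(s{\restriction}\mathrm{lh}(t))\cdot t$; $s\cdot T=\{s\cdot t:t\in T\}$; $T{\restriction}s=\{t\in T:s\subseteq t\lor t\subseteq s\}$. The stem of a perfect tree $T$ is the largest $s\in T$ with $T=T{\restriction}s$. $\mathbf{LT}$ is the set of perfect trees $T\subseteq2^{<\omega}$ for which there are nonempty strings $q^m_i$ ($m<\omega,i<2$) with $\mathrm{lh}(q^m_0)=\mathrm{lh}(q^m_1)$, $q^m_i(0)=i$, such that $T$ consists of all initial segments of strings $\mathrm{stem}(T)^\frown q^0_{i(0)}{}^\frown\cdots{}^\frown q^m_{i(m)}$; $\mathrm{spl}_0(T)=\mathrm{lh}(\mathrm{stem}(T))$, $\mathrm{spl}_{m+1}(T)=\mathrm{spl}_m(T)+\mathrm{lh}(q^m_0)$. For $T\in\mathbf{LT}$: $T(\to i)=T{\restriction}(\mathrm{stem}(T)^\frown i)$, and for $s\in2^m$, $T(\to s)=(\cdots(T(\to s(0)))\cdots)(\to s(m-1))$, $T(\to\Lambda)=T$. $S\subseteq_n T$ means $S\subseteq T$ and $\mathrm{spl}_k(S)=\mathrm{spl}_k(T)$ for $k<n$. A large-tree forcing notion is a set $\mathbb P\subseteq\mathbf{LT}$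 such that $T{\restriction}u\in\mathbb P$ whenever $u\in T\in\mathbb P$, and $s\cdot T\in\mathbb P$ whenever $T\in\mathbb P$, $s\in2^{<\omega}$; it is ordered by inclusion (smaller is stronger). $D\subseteq\mathbb P$ is open dense if every $S\in\mathbb P$ has some $T\in D$ with $T\subseteq S$, and $S\subseteq T\in D$, $S\in\mathbb P$ imply $S\in D$. $\mathbf{LC}_n(\mathbb P)$ is the set of all $T\in\mathbf{LT}$ such that $T(\to s)\in\mathbb P$ for all $s\in2^n$. -}

module Defs where

open import Level using (0ℓ)
open import Data.Bool using (Bool; true; false; _xor_)
open import Data.List using (List; []; _∷_; _++_; length; [_])
open import Data.Nat using (ℕ; zero; suc; _+_; _<_)
open import Data.Product using (Σ; Σ-syntax; ∃; _×_; _,_)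
open import Data.Sum using (_⊎_)
open import Relation.Binary.PropositionalEquality using (_≡_)
open import Relation.Unary using (Pred; _⊆_; _≐_)

Str : Set
Str = List Bool

_⊑_ : Str → Str → Set
s ⊑ t = Σ Str λ r → s ++ r ≡ t

Tree : Set₁
Tree = Pred Str 0ℓ

-- s · t  (covers both cases lh s ≤ lh t and lh s > lh t)
_·_ : Str → Str → Str
[]      · t       = t
(a ∷ s) · []      = []
(a ∷ s) · (b ∷ t) = (b xor a) ∷ (s · t)

_·T_ : Str → Tree → Tree
(s ·T T) v = Σ Str λ t → T t × v ≡ s · t

_↾_ : Tree → Str → Tree
(T ↾ s) t = T t × (s ⊑ t ⊎ t ⊑ s)

path : (ℕ → Bool → Str) → (ℕ → Bool) → ℕ → Str
path q c zero    = []
path q c (suc m) = path q c m ++ q m (c m)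

generated : Str → (ℕ → Bool → Str) → Tree
generated st q u = Σ (ℕ → Bool) λ c → Σ ℕ λ m → u ⊑ (st ++ path q c m)

record IsLT (T : Tree) : Set where
  field
    stem    : Str
    q       : ℕ → Bool → Str
    q-head  : ∀ m i → Σ Str λ r → q m i ≡ i ∷ r
    q-len   : ∀ m → length (q m false) ≡ length (q m true)
    q-gen   : T ≐ generated stem q

spl : {T : Tree} → IsLT T → ℕ → ℕ
spl w zero    = length (IsLT.stem w)
spl w (suc k) = spl w k + length (IsLT.q w k false)

IsStem : Tree → Str → Set
IsStem T s = T s × (T ≐ (T ↾ s)) × (∀ s′ → T s′ → T ≐ (T ↾ s′) → s′ ⊑ s)

_→₁_ : Tree → Bool → Tree
(T →₁ i) v = Σ Str λ s → IsStem T s × (T ↾ (s ++ [ i ])) v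

_⇒_ : Tree → Str → Tree
T ⇒ []      = T
T ⇒ (b ∷ s) = (T →₁ b) ⇒ s

SubN : ℕ → Tree → Tree → Set
SubN n S T = (S ⊆ T) × (∀ (wS : IsLT S) (wT : IsLT T) k → k < n → spl wS k ≡ spl wT k)

-- large-tree forcing notion (closure under ≐ only reflects set extensionality)
record IsLTForcing (ℙ : Pred Tree 0ℓ) : Set₁ where
  field
    ⊆LT    : ∀ T → ℙ T → IsLT T
    restr  : ∀ T u → T u → ℙ T → ℙ (T ↾ u)
    shift  : ∀ T s → ℙ T → ℙ (s ·T T)
    extens : ∀ T T′ → T ≐ T′ → ℙ T → ℙ T′

record OpenDense (ℙ D : Pred Tree 0ℓ) : Set₁ where
  field
    D⊆ℙ   : ∀ T → D T → ℙ T
    dense : ∀ S → ℙ S → Σ Tree λ T → D T × T ⊆ S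
    open′ : ∀ S T → ℙ S → S ⊆ T → D T → D S

LC : ℕ → Pred Tree 0ℓ → Tree → Set
LC n ℙ T = IsLT T × (∀ s → length s ≡ n → ℙ (T ⇒ s))

-- Every tree in LT is `generated X q`: a stem X followed by levels of
-- splitting strings q^m_0, q^m_1 of equal length.  The argument rests on
-- two computations with such trees: a cone T(→ u) of a generated tree is
-- again generated, with stem X ⌢ q^0_{u(0)} ⌢ ... and the remaining levels
-- (⇒-generated), and translating a generated tree by σ translates its stem
-- (translate-generated).  Hence all cones of one level are translates of
-- each other, which gives (i) since ℙ is closed under translation.  For (ii)
-- and (iv) we graft: keep the first n levels of P and replace everything
-- from level n on by a new splitting structure (module Graft); one "anchor"
-- cone per final bit that lies in ℙ and inside P suffices, by translation
-- again.  (iii) iterates (ii) over all strings of length n.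

module Submission where

open import Defs
open import Level using (0ℓ)
open import Data.Bool using (Bool; true; false; _xor_; not)
open import Data.Bool.Properties using (xor-assoc; xor-same; xor-identityʳ; not-¬)
open import Data.List using (List; []; _∷_; length; _++_; [_]; map; initLast; _∷ʳ′_)
open import Data.List.Properties using (++-assoc; ++-identityʳ; length-++)
open import Data.List.Membership.Propositional using (_∈_)
open import Data.List.Membership.Propositional.Properties using (∈-map⁺; ∈-++⁺ˡ; ∈-++⁺ʳ)
open import Data.List.Relation.Unary.All as All using (All; []; _∷_)
open import Data.List.Relation.Unary.All.Properties using (++⁺; map⁺)
open import Data.List.Relation.Unary.Any using (here)
open import Data.Nat using (ℕ; zero; suc; _+_; _≤_; _<_; z≤n; s≤s)
open import Data.Nat.Properties
  using (m≤m+n; m≤n+m; ≤-trans; ≤-refl; +-comm; +-cancelˡ-≡; n≤1+n; 0≢1+n; <-≤-trans; suc-injective; ≤-pred)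
open import Data.Product using (Σ; _×_; _,_; proj₁; proj₂)
open import Data.Sum using (_⊎_; inj₁; inj₂)
open import Data.Empty using (⊥-elim)
open import Relation.Nullary using (¬_)
open import Relation.Binary.PropositionalEquality
  using (_≡_; refl; sym; trans; cong; cong₂; subst; module ≡-Reasoning)
open import Relation.Unary using (Pred; _⊆_; _≐_)

⊑-++ : ∀ a b → a ⊑ (a ++ b)
⊑-++ a b = b , refl

⊑-[] : ∀ a → [] ⊑ a
⊑-[] a = a , refl

⊑-trans : ∀ {a b c} → a ⊑ b → b ⊑ c → a ⊑ c
⊑-trans {a} (r , refl) (r′ , refl) = r ++ r′ , sym (++-assoc a r r′)

⊑-∷ : ∀ x {a b} → a ⊑ b → (x ∷ a) ⊑ (x ∷ b)
⊑-∷ x (r , refl) = r , refl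

⊑-∷⁻ : ∀ {x y a b} → (x ∷ a) ⊑ (y ∷ b) → (x ≡ y) × (a ⊑ b)
⊑-∷⁻ (r , refl) = refl , (r , refl)

⊑-++ˡ : ∀ c {a b} → a ⊑ b → (c ++ a) ⊑ (c ++ b)
⊑-++ˡ c {a} (r , refl) = r , ++-assoc c a r

⊑-++ˡ⁻ : ∀ c {a b} → (c ++ a) ⊑ (c ++ b) → a ⊑ b
⊑-++ˡ⁻ []      h = h
⊑-++ˡ⁻ (x ∷ c) h = ⊑-++ˡ⁻ c (proj₂ (⊑-∷⁻ h))

⊑-length : ∀ {a b} → a ⊑ b → length a ≤ length b
⊑-length {a} (r , refl) = subst (length a ≤_) (sym (length-++ a)) (m≤m+n _ _)

⊑-comparable : ∀ {a b c} → a ⊑ c → b ⊑ c → a ⊑ b ⊎ b ⊑ a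
⊑-comparable {[]}    _ _ = inj₁ (⊑-[] _)
⊑-comparable {_ ∷ _} {[]} _ _ = inj₂ (⊑-[] _)
⊑-comparable {x ∷ a} {y ∷ b} {[]} (r , ()) _
⊑-comparable {x ∷ a} {y ∷ b} {z ∷ c} p q with ⊑-∷⁻ p | ⊑-∷⁻ q
... | refl , p′ | refl , q′ with ⊑-comparable p′ q′
... | inj₁ h = inj₁ (⊑-∷ x h)
... | inj₂ h = inj₂ (⊑-∷ x h)

⊑-by-length : ∀ {a b c} → a ⊑ c → b ⊑ c → length a ≤ length b → a ⊑ b
⊑-by-length {[]}    _ _ _ = ⊑-[] _
⊑-by-length {_ ∷ _} {[]} _ _ ()
⊑-by-length {x ∷ a} {y ∷ b} {[]} (r , ()) _
⊑-by-length {x ∷ a} {y ∷ b} {z ∷ c} p q (s≤s l) with ⊑-∷⁻ p | ⊑-∷⁻ q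
... | refl , p′ | refl , q′ = ⊑-∷ x (⊑-by-length p′ q′ l)

⊑-antisym : ∀ {a b} → a ⊑ b → b ⊑ a → a ≡ b
⊑-antisym p q = go p (⊑-length q)
  where
  go : ∀ {a b} → a ⊑ b → length b ≤ length a → a ≡ b
  go {[]}    {[]}    _ _ = refl
  go {[]}    {_ ∷ _} _ ()
  go {x ∷ a} {[]}    (r , ()) _
  go {x ∷ a} {y ∷ b} p (s≤s l) with ⊑-∷⁻ p
  ... | refl , p′ = cong (x ∷_) (go p′ l)

⊑-fork : ∀ s {A b b′ p p′} → A ⊑ (s ++ (b ∷ p)) → A ⊑ (s ++ (b′ ∷ p′)) → ¬ (b ≡ b′) →
         length A ≤ length s
⊑-fork s       {[]}    _ _ _ = z≤n
⊑-fork []      {x ∷ A} p q b≢b′ with ⊑-∷⁻ p | ⊑-∷⁻ q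
... | refl , _ | refl , _ = ⊥-elim (b≢b′ refl)
⊑-fork (y ∷ s) {x ∷ A} p q b≢b′ = s≤s (⊑-fork s (proj₂ (⊑-∷⁻ p)) (proj₂ (⊑-∷⁻ q)) b≢b′)

⊑-head : ∀ s {a b p p′} → (s ++ (a ∷ p)) ⊑ (s ++ (b ∷ p′)) → a ≡ b
⊑-head s h = proj₁ (⊑-∷⁻ (⊑-++ˡ⁻ s h))

⊑-proper : ∀ s {a p} → ¬ ((s ++ (a ∷ p)) ⊑ (s ++ []))
⊑-proper s h with ⊑-++ˡ⁻ s h
... | _ , ()

length-++-≥ : ∀ (a b : Str) → length b ≤ length (a ++ b)
length-++-≥ a b = subst (length b ≤_) (sym (length-++ a)) (m≤n+m (length b) (length a))

extension-length : ∀ (A₀ A₁ f g : Str) → length A₀ ≡ length A₁ → length (A₀ ++ f) ≡ length (A₁ ++ g) →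
                   length f ≡ length g
extension-length A₀ A₁ f g eA e = +-cancelˡ-≡ (length A₀) _ _ (begin
  length A₀ + length f   ≡⟨ sym (length-++ A₀) ⟩
  length (A₀ ++ f)       ≡⟨ e ⟩
  length (A₁ ++ g)       ≡⟨ length-++ A₁ ⟩
  length A₁ + length g   ≡⟨ cong (_+ length g) (sym eA) ⟩
  length A₀ + length g   ∎)
  where open ≡-Reasoning

·-length : ∀ σ v → length (σ · v) ≡ length v
·-length []      v       = refl
·-length (a ∷ σ) []      = refl
·-length (a ∷ σ) (b ∷ v) = cong suc (·-length σ v)

·-involutive : ∀ σ v → σ · (σ · v) ≡ v
·-involutive []      v       = refl
·-involutive (a ∷ σ) []      = refl
·-involutive (a ∷ σ) (b ∷ v) = cong₂ _∷_ xor-cancel (·-involutive σ v)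
  where
  xor-cancel : (b xor a) xor a ≡ b
  xor-cancel = trans (xor-assoc b a a) (trans (cong (b xor_) (xor-same a)) (xor-identityʳ b))

·-++ : ∀ σ X Y → length σ ≤ length X → σ · (X ++ Y) ≡ (σ · X) ++ Y
·-++ []      X       Y _       = refl
·-++ (a ∷ σ) []      Y ()
·-++ (a ∷ σ) (x ∷ X) Y (s≤s l) = cong ((x xor a) ∷_) (·-++ σ X Y l)

·-mono : ∀ σ {v w} → v ⊑ w → (σ · v) ⊑ (σ · w)
·-mono []      p = p
·-mono (a ∷ σ) {[]}    _ = ⊑-[] _
·-mono (a ∷ σ) {x ∷ v} {[]} (r , ())
·-mono (a ∷ σ) {x ∷ v} {y ∷ w} p with ⊑-∷⁻ p
... | refl , p′ = ⊑-∷ _ (·-mono σ p′)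

diff : Str → Str → Str
diff []      Y       = []
diff (x ∷ X) []      = []
diff (x ∷ X) (y ∷ Y) = (x xor y) ∷ diff X Y

diff-· : ∀ X Y → length X ≡ length Y → diff X Y · X ≡ Y
diff-· []      []      _ = refl
diff-· []      (_ ∷ _) ()
diff-· (x ∷ X) []      ()
diff-· (x ∷ X) (y ∷ Y) e = cong₂ _∷_ xor-cancel (diff-· X Y (suc-injective e))
  where
  xor-cancel : x xor (x xor y) ≡ y
  xor-cancel = trans (sym (xor-assoc x x y)) (cong (_xor y) (xor-same x))

diff-length : ∀ X Y → length (diff X Y) ≤ length X
diff-length []      Y       = z≤n
diff-length (x ∷ X) []      = z≤n
diff-length (x ∷ X) (y ∷ Y) = s≤s (diff-length X Y)

Splitting : (ℕ → Bool → Str) → Set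
Splitting q = ∀ m i → Σ Str λ r → q m i ≡ i ∷ r

Balanced : (ℕ → Bool → Str) → Set
Balanced q = ∀ m → length (q m false) ≡ length (q m true)

split-head : ∀ {q} → Splitting q → ∀ m i → [ i ] ⊑ q m i
split-head hq m i = proj₁ (hq m i) , sym (proj₂ (hq m i))

balanced : ∀ {q} → Balanced q → ∀ m b b′ → length (q m b) ≡ length (q m b′)
balanced lq m false false = refl
balanced lq m false true  = lq m
balanced lq m true  false = sym (lq m)
balanced lq m true  true  = refl

after : {A : Set} → ℕ → (ℕ → A) → ℕ → A
after N f k = f (N + k)

branch : (ℕ → Bool → Str) → Str → Str
branch q []      = []
branch q (b ∷ u) = q 0 b ++ branch (after 1 q) u

initial : ℕ → (ℕ → Bool) → Str
initial zero    c = []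
initial (suc N) c = c 0 ∷ initial N (after 1 c)

toSeq : Str → ℕ → Bool
toSeq []      k       = false
toSeq (b ∷ u) zero    = b
toSeq (b ∷ u) (suc k) = toSeq u k

initial-length : ∀ N c → length (initial N c) ≡ N
initial-length zero    c = refl
initial-length (suc N) c = cong suc (initial-length N _)

initial-toSeq : ∀ u → initial (length u) (toSeq u) ≡ u
initial-toSeq []      = refl
initial-toSeq (b ∷ u) = cong (b ∷_) (initial-toSeq u)

branch-snoc : ∀ q u b → branch q (u ++ [ b ]) ≡ branch q u ++ q (length u) b
branch-snoc q []      b = ++-identityʳ (q 0 b)
branch-snoc q (a ∷ u) b =
  trans (cong (q 0 a ++_) (branch-snoc (after 1 q) u b)) (sym (++-assoc (q 0 a) _ _))

branch-length : ∀ {q} → Balanced q → ∀ u u′ → length u ≡ length u′ →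
                length (branch q u) ≡ length (branch q u′)
branch-length lq []      []        e = refl
branch-length {q} lq (b ∷ u) (b′ ∷ u′) e = begin
  length (q 0 b ++ branch (after 1 q) u)             ≡⟨ length-++ (q 0 b) ⟩
  length (q 0 b) + length (branch (after 1 q) u)     ≡⟨ cong₂ _+_ (balanced {q} lq 0 b b′)
                                                          (branch-length {after 1 q} (λ m → lq (suc m)) u u′ (suc-injective e)) ⟩
  length (q 0 b′) + length (branch (after 1 q) u′)   ≡⟨ sym (length-++ (q 0 b′)) ⟩
  length (q 0 b′ ++ branch (after 1 q) u′)           ∎
  where open ≡-Reasoning

-- Every bit contributes at least one symbol to a branch.
branch-long : ∀ {q} → Splitting q → ∀ u → length u ≤ length (branch q u)
branch-long hq []      = z≤n
branch-long {q} hq (b ∷ u) with hq 0 b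
... | z , e = subst (λ w → suc (length u) ≤ length (w ++ branch (after 1 q) u)) (sym e)
                (s≤s (≤-trans (branch-long (λ m → hq (suc m)) u) (length-++-≥ z _)))

path-front : ∀ q c m → path q c (suc m) ≡ q 0 (c 0) ++ path (after 1 q) (after 1 c) m
path-front q c zero    = sym (++-identityʳ (q 0 (c 0)))
path-front q c (suc m) =
  trans (cong (_++ q (suc m) (c (suc m))) (path-front q c m)) (++-assoc (q 0 (c 0)) _ _)

path-initial : ∀ q c N → path q c N ≡ branch q (initial N c)
path-initial q c zero    = refl
path-initial q c (suc N) = trans (path-front q c N) (cong (q 0 (c 0) ++_) (path-initial _ _ N))

path-split : ∀ q c N m → path q c (N + m) ≡ path q c N ++ path (after N q) (after N c) m
path-split q c zero    m = refl
path-split q c (suc N) m = begin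
  path q c (suc N + m)                                                ≡⟨ path-front q c (N + m) ⟩
  q 0 (c 0) ++ path (after 1 q) (after 1 c) (N + m)                   ≡⟨ cong (q 0 (c 0) ++_)
                                                                          (path-split (after 1 q) (after 1 c) N m) ⟩
  q 0 (c 0) ++ (path (after 1 q) (after 1 c) N ++ R)                  ≡⟨ sym (++-assoc (q 0 (c 0)) _ _) ⟩
  (q 0 (c 0) ++ path (after 1 q) (after 1 c) N) ++ R                  ≡⟨ cong (_++ R) (sym (path-front q c N)) ⟩
  path q c (suc N) ++ R                                               ∎
  where
  open ≡-Reasoning
  R = path (after (suc N) q) (after (suc N) c) m

path-cong : ∀ {q q′} c m → (∀ m i → q m i ≡ q′ m i) → path q c m ≡ path q′ c m
path-cong c zero    e = refl
path-cong c (suc m) e = cong₂ _++_ (path-cong c m e) (e m (c m))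

≐-sym : ∀ {T T′ : Tree} → T ≐ T′ → T′ ≐ T
≐-sym (a , b) = b , a

≐-trans : ∀ {T T′ T″ : Tree} → T ≐ T′ → T′ ≐ T″ → T ≐ T″
≐-trans (a , b) (c , d) = (λ x → c (a x)) , (λ x → b (d x))

generated-cong : ∀ {X X′ q q′} → X ≡ X′ → (∀ m i → q m i ≡ q′ m i) →
                 generated X q ≐ generated X′ q′
generated-cong {X} {X′} {q} {q′} eX eq =
    (λ { {v} (c , m , p) → c , m , subst (v ⊑_) (same c m) p })
  , (λ { {v} (c , m , p) → c , m , subst (v ⊑_) (sym (same c m)) p })
  where
  same : ∀ c m → X ++ path q c m ≡ X′ ++ path q′ c m
  same c m = cong₂ _++_ eX (path-cong c m eq)

generated-stem-cong : ∀ {X X′ q} → X ≡ X′ → generated X q ≐ generated X′ q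
generated-stem-cong e = generated-cong e (λ _ _ → refl)

generated-down : ∀ {X q a b} → a ⊑ b → generated X q b → generated X q a
generated-down ab (c , m , p) = c , m , ⊑-trans ab p

generated-root : ∀ {X q} → generated X q X
generated-root = (λ _ → false) , 0 , ([] , refl)

generated-branch : ∀ X q u → generated X q (X ++ branch q u)
generated-branch X q u = toSeq u , length u , ([] , (begin
  (X ++ branch q u) ++ []                          ≡⟨ ++-identityʳ _ ⟩
  X ++ branch q u                                  ≡⟨ cong (λ w → X ++ branch q w) (sym (initial-toSeq u)) ⟩
  X ++ branch q (initial (length u) (toSeq u))     ≡⟨ cong (X ++_) (sym (path-initial q (toSeq u) (length u))) ⟩
  X ++ path q (toSeq u) (length u)                 ∎))
  where open ≡-Reasoning

generated-comparable : ∀ {X q v} → generated X q v → X ⊑ v ⊎ v ⊑ X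
generated-comparable {X} (c , m , p) = ⊑-comparable (⊑-++ X _) p

generated-long : ∀ {X q v} → generated X q v → length X ≤ length v → X ⊑ v
generated-long {X} (c , m , p) l = ⊑-by-length (⊑-++ X _) p l

-- The stem of `generated X q` is X: X is the last node below which the
-- tree does not branch, since X ⌢ q^0_0 and X ⌢ q^0_1 both belong to it.
generated-stem : ∀ {X q} → Splitting q → IsStem (generated X q) X
generated-stem {X} {q} hq = generated-root , ((λ p → p , generated-comparable p) , proj₁) , maximal
  where
  successor : ∀ i → generated X q (X ++ q 0 i)
  successor i = (λ _ → i) , 1 , ([] , ++-identityʳ _)
  maximal : ∀ s′ → generated X q s′ → generated X q ≐ (generated X q ↾ s′) → s′ ⊑ X
  maximal s′ gs eq with generated-comparable gs
  ... | inj₂ h = h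
  ... | inj₁ ([] , refl) = [] , trans (++-identityʳ _) (++-identityʳ _)
  ... | inj₁ ((x ∷ d) , refl) with hq 0 (not x) | proj₁ eq (successor (not x))
  ...   | r , e | _ , inj₁ h =
          ⊥-elim (not-¬ refl (⊑-head X (subst (λ z → (X ++ (x ∷ d)) ⊑ (X ++ z)) e h)))
  ...   | r , e | _ , inj₂ h =
          ⊥-elim (not-¬ refl (sym (⊑-head X (subst (λ z → (X ++ z) ⊑ (X ++ (x ∷ d))) e h))))

stem-unique : ∀ {T s s′} → IsStem T s → IsStem T s′ → s ≡ s′
stem-unique (ts , eq , mx) (ts′ , eq′ , mx′) = ⊑-antisym (mx′ _ ts eq) (mx _ ts′ eq′)

↾-resp : ∀ {T T′ : Tree} s → T ≐ T′ → (T ↾ s) ≐ (T′ ↾ s)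
↾-resp s (a , b) = (λ { (x , y) → a x , y }) , (λ { (x , y) → b x , y })

IsStem-resp : ∀ {T T′ s} → T ≐ T′ → IsStem T s → IsStem T′ s
IsStem-resp {T} {T′} {s} e@(a , b) (ts , eq , mx) = a ts , eq′ , mx′
  where
  eq′ : T′ ≐ (T′ ↾ s)
  eq′ = ≐-trans (≐-sym e) (≐-trans eq (↾-resp s e))
  mx′ : ∀ s′ → T′ s′ → T′ ≐ (T′ ↾ s′) → s′ ⊑ s
  mx′ s′ t′ eqs′ = mx s′ (b t′) (≐-trans e (≐-trans eqs′ (↾-resp s′ (≐-sym e))))

→₁-resp : ∀ {T T′ : Tree} i → T ≐ T′ → (T →₁ i) ≐ (T′ →₁ i)
→₁-resp i e = (λ { (s , st , x) → s , IsStem-resp e st , proj₁ (↾-resp _ e) x })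
            , (λ { (s , st , x) → s , IsStem-resp (≐-sym e) st , proj₂ (↾-resp _ e) x })

⇒-resp : ∀ {T T′ : Tree} u → T ≐ T′ → (T ⇒ u) ≐ (T′ ⇒ u)
⇒-resp []      e = e
⇒-resp (b ∷ u) e = ⇒-resp u (→₁-resp b e)

⇒-⊆ : ∀ (T : Tree) u → (T ⇒ u) ⊆ T
⇒-⊆ T []      x = x
⇒-⊆ T (b ∷ u) x = proj₁ (proj₂ (proj₂ (⇒-⊆ (T →₁ b) u x)))

·T-resp : ∀ σ {T T′ : Tree} → T ≐ T′ → (σ ·T T) ≐ (σ ·T T′)
·T-resp σ (a , b) = (λ { (t , x , e) → t , a x , e }) , (λ { (t , x , e) → t , b x , e })

·T-mono : ∀ σ {T T′ : Tree} → T ⊆ T′ → (σ ·T T) ⊆ (σ ·T T′)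
·T-mono σ a (t , x , e) = t , a x , e

first-choice : ∀ {q} → Splitting q → ∀ X i c m v → (X ++ [ i ]) ⊑ v → v ⊑ (X ++ path q c (suc m)) →
               v ⊑ ((X ++ q 0 i) ++ path (after 1 q) (after 1 c) m)
first-choice {q} hq X i c m v a p with hq 0 (c 0)
... | r , e = subst (v ⊑_) (sym (++-assoc X (q 0 i) R))
                (subst (λ b → v ⊑ (X ++ (q 0 b ++ R))) (sym i≡c0) p′)
  where
  R = path (after 1 q) (after 1 c) m
  p′ : v ⊑ (X ++ (q 0 (c 0) ++ R))
  p′ = subst (λ z → v ⊑ (X ++ z)) (path-front q c m) p
  i≡c0 : i ≡ c 0
  i≡c0 = ⊑-head X (⊑-trans a (subst (λ z → v ⊑ (X ++ (z ++ R))) e p′))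

→₁-generated : ∀ {X q} → Splitting q → ∀ i → (generated X q →₁ i) ≐ generated (X ++ q 0 i) (after 1 q)
→₁-generated {X} {q} hq i = to , from
  where
  X⌢i⊑ : (X ++ [ i ]) ⊑ (X ++ q 0 i)
  X⌢i⊑ = ⊑-++ˡ X (split-head hq 0 i)
  to : (generated X q →₁ i) ⊆ generated (X ++ q 0 i) (after 1 q)
  to {v} (s , isS , _) with stem-unique isS (generated-stem {X} hq)
  to {v} (s , isS , ((c , m , p) , inj₂ h)) | refl =
    c , 0 , subst (v ⊑_) (sym (++-identityʳ _)) (⊑-trans h X⌢i⊑)
  to {v} (s , isS , ((c , zero , p) , inj₁ h)) | refl = ⊥-elim (⊑-proper X (⊑-trans h p))
  to {v} (s , isS , ((c , suc m , p) , inj₁ h)) | refl = after 1 c , m , first-choice hq X i c m v h p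
  from : generated (X ++ q 0 i) (after 1 q) ⊆ (generated X q →₁ i)
  from {v} (c′ , m , p) = X , generated-stem hq , (in-tree , ⊑-comparable above p)
    where
    R = path (after 1 q) c′ m
    c : ℕ → Bool
    c zero    = i
    c (suc k) = c′ k
    in-tree : generated X q v
    in-tree = c , suc m ,
      subst (v ⊑_) (trans (++-assoc X (q 0 i) R) (cong (X ++_) (sym (path-front q c m)))) p
    above : (X ++ [ i ]) ⊑ ((X ++ q 0 i) ++ R)
    above = ⊑-trans X⌢i⊑ (⊑-++ _ _)

⇒-generated : ∀ {X q} → Splitting q → ∀ u N → length u ≡ N →
              (generated X q ⇒ u) ≐ generated (X ++ branch q u) (after N q)
⇒-generated {X} {q} hq []      zero    refl = generated-stem-cong (sym (++-identityʳ X))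
⇒-generated {X} {q} hq (b ∷ u) (suc N) e =
  ≐-trans (⇒-resp u (→₁-generated hq b))
  (≐-trans (⇒-generated {X ++ q 0 b} {after 1 q} (λ m → hq (suc m)) u N (suc-injective e))
           (generated-stem-cong (++-assoc X (q 0 b) _)))

translate-generated : ∀ σ X r → length σ ≤ length X → (σ ·T generated X r) ≐ generated (σ · X) r
translate-generated σ X r l = to , from
  where
  to : (σ ·T generated X r) ⊆ generated (σ · X) r
  to (t , (c , m , p) , refl) = c , m , subst ((σ · t) ⊑_) (·-++ σ X (path r c m) l) (·-mono σ p)
  from : generated (σ · X) r ⊆ (σ ·T generated X r)
  from {v} (c , m , p) = σ · v , (c , m , subst ((σ · v) ⊑_) back (·-mono σ p)) , sym (·-involutive σ v)
    where
    P = path r c m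
    back : σ · ((σ · X) ++ P) ≡ X ++ P
    back = trans (·-++ σ (σ · X) P (subst (length σ ≤_) (sym (·-length σ X)) l))
                 (cong (_++ P) (·-involutive σ X))

translate-stem : ∀ X Y r → length X ≡ length Y → (diff X Y ·T generated X r) ≐ generated Y r
translate-stem X Y r e =
  ≐-trans (translate-generated (diff X Y) X r (diff-length X Y)) (generated-stem-cong (diff-· X Y e))

translate-cone : ∀ X Y E r → length X ≡ length Y → (diff X Y ·T generated (X ++ E) r) ≐ generated (Y ++ E) r
translate-cone X Y E r e =
  ≐-trans (translate-generated (diff X Y) (X ++ E) r (≤-trans (diff-length X Y) (⊑-length (⊑-++ X E))))
          (generated-stem-cong (trans (·-++ _ X E (diff-length X Y)) (cong (_++ E) (diff-· X Y e))))

transport-⊆ : ∀ X Y E r r′ → length X ≡ length Y →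
              generated (X ++ E) r ⊆ generated X r′ → generated (Y ++ E) r ⊆ generated Y r′
transport-⊆ X Y E r r′ e h x =
  proj₁ (translate-stem X Y r′ e) (·T-mono (diff X Y) h (proj₂ (translate-cone X Y E r e) x))

open IsLT using (stem; q-head; q-len; q-gen) renaming (q to splitting)

cone : ∀ {T} (w : IsLT T) u N → length u ≡ N →
       (T ⇒ u) ≐ generated (stem w ++ branch (splitting w) u) (after N (splitting w))
cone w u N e = ≐-trans (⇒-resp u (q-gen w)) (⇒-generated (q-head w) u N e)

cone-stem : ∀ {T} → IsLT T → ℕ → Str → Bool → Str
cone-stem w n u b = stem w ++ (branch (splitting w) u ++ splitting w n b)

cone-snoc : ∀ {T} (w : IsLT T) n u b → length u ≡ n →
            (T ⇒ (u ++ [ b ])) ≐ generated (cone-stem w n u b) (after (suc n) (splitting w))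
cone-snoc w n u b refl =
  ≐-trans (cone w (u ++ [ b ]) (suc n) (trans (length-++ u) (+-comm (length u) 1)))
          (generated-stem-cong (cong (stem w ++_) (branch-snoc (splitting w) u b)))

cone-stem-length : ∀ {T} (w : IsLT T) n u b u′ b′ → length u ≡ n → length u′ ≡ n →
                   length (cone-stem w n u b) ≡ length (cone-stem w n u′ b′)
cone-stem-length w n u b u′ b′ l l′ = begin
  length (stem w ++ (B u ++ q n b))                ≡⟨ length-++ (stem w) ⟩
  length (stem w) + length (B u ++ q n b)          ≡⟨ cong (length (stem w) +_) (length-++ (B u)) ⟩
  length (stem w) + (length (B u) + length (q n b)) ≡⟨ cong (λ k → length (stem w) + k)
       (cong₂ _+_ (branch-length {q} (q-len w) u u′ (trans l (sym l′))) (balanced {q} (q-len w) n b b′)) ⟩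
  length (stem w) + (length (B u′) + length (q n b′)) ≡⟨ cong (length (stem w) +_) (sym (length-++ (B u′))) ⟩
  length (stem w) + length (B u′ ++ q n b′)         ≡⟨ sym (length-++ (stem w)) ⟩
  length (stem w ++ (B u′ ++ q n b′))               ∎
  where
  open ≡-Reasoning
  q = splitting w
  B = branch q

lt-down : ∀ {T} → IsLT T → ∀ {a b} → a ⊑ b → T b → T a
lt-down w ab tb = proj₂ (q-gen w) (generated-down ab (proj₁ (q-gen w) tb))

lt-stem : ∀ {T} (w : IsLT T) → IsStem T (stem w)
lt-stem w = IsStem-resp (≐-sym (q-gen w)) (generated-stem (q-head w))

-- spl_k(T) is the length of the stem of the cone T(→ 0^k); in particular it
-- does not depend on the witness.
spl-unique : ∀ {T} (w₁ w₂ : IsLT T) k → spl w₁ k ≡ spl w₂ k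
spl-unique {T} w₁ w₂ k = begin
  spl w₁ k                                     ≡⟨ spl-branch w₁ ⟩
  length (stem w₁ ++ branch (splitting w₁) 0ᵏ) ≡⟨ cong length same-stem ⟩
  length (stem w₂ ++ branch (splitting w₂) 0ᵏ) ≡⟨ sym (spl-branch w₂) ⟩
  spl w₂ k                                     ∎
  where
  open ≡-Reasoning
  0ᵏ = initial k (λ _ → false)
  spl-path : (w : IsLT T) → ∀ k → spl w k ≡ length (stem w ++ path (splitting w) (λ _ → false) k)
  spl-path w zero    = sym (cong length (++-identityʳ (stem w)))
  spl-path w (suc k) = trans (cong (_+ length (splitting w k false)) (spl-path w k))
    (sym (trans (cong length (sym (++-assoc (stem w) (path (splitting w) (λ _ → false) k) (splitting w k false))))
                (length-++ (stem w ++ path (splitting w) (λ _ → false) k))))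
  spl-branch : (w : IsLT T) → spl w k ≡ length (stem w ++ branch (splitting w) 0ᵏ)
  spl-branch w = trans (spl-path w k) (cong (λ p → length (stem w ++ p)) (path-initial (splitting w) _ k))
  cone₁ = cone w₁ 0ᵏ k (initial-length k _)
  cone₂ = cone w₂ 0ᵏ k (initial-length k _)
  same-stem : stem w₁ ++ branch (splitting w₁) 0ᵏ ≡ stem w₂ ++ branch (splitting w₂) 0ᵏ
  same-stem = stem-unique (IsStem-resp (≐-trans (≐-sym cone₁) cone₂) (generated-stem (λ m → q-head w₁ (k + m))))
                          (generated-stem (λ m → q-head w₂ (k + m)))

spl-agree : ∀ {T T′} (w₁ : IsLT T) (w₂ : IsLT T′) → stem w₁ ≡ stem w₂ → ∀ k →
            (∀ j → j < k → splitting w₁ j false ≡ splitting w₂ j false) → spl w₁ k ≡ spl w₂ k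
spl-agree w₁ w₂ e zero    h = cong length e
spl-agree w₁ w₂ e (suc k) h =
  cong₂ _+_ (spl-agree w₁ w₂ e k (λ j l → h j (≤-trans l (n≤1+n k)))) (cong length (h k ≤-refl))

SubN-trans : ∀ {n A B C} → SubN n A B → IsLT B → SubN n B C → SubN n A C
SubN-trans (s₁ , e₁) wB (s₂ , e₂) = (λ x → s₂ (s₁ x)) , λ wA wC k l → trans (e₁ wA wB k l) (e₂ wB wC k l)

-- If all N-th level cones of Q lie in a downward closed R, then Q ⊆ R:
-- every node of Q lies below a node of some such cone.
cover : ∀ {Q} (w : IsLT Q) N (R : Tree) → (∀ {a b} → a ⊑ b → R b → R a) →
        (∀ u → length u ≡ N → (Q ⇒ u) ⊆ R) → Q ⊆ R
cover {Q} w N R down h {v} qv with proj₁ (q-gen w) qv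
... | c , m , p = down v⊑long (h u (initial-length N c) (proj₂ (cone w u N (initial-length N c)) long∈cone))
  where
  X = stem w
  q = splitting w
  u = initial N c
  R′ = path (after N q) (after N c) m
  long = X ++ path q c (N + m)
  v⊑long : v ⊑ long
  v⊑long = ⊑-trans p (⊑-++ˡ X (subst (path q c m ⊑_) (cong (path q c) (+-comm m N))
             (subst (path q c m ⊑_) (sym (path-split q c m N)) (⊑-++ _ _))))
  long∈cone : generated (X ++ branch q u) (after N q) long
  long∈cone = after N c , m , ([] , (begin
    long ++ []                    ≡⟨ ++-identityʳ long ⟩
    X ++ path q c (N + m)         ≡⟨ cong (X ++_) (path-split q c N m) ⟩
    X ++ (path q c N ++ R′)       ≡⟨ cong (λ z → X ++ (z ++ R′)) (path-initial q c N) ⟩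
    X ++ (branch q u ++ R′)       ≡⟨ sym (++-assoc X (branch q u) R′) ⟩
    (X ++ branch q u) ++ R′       ∎))
    where open ≡-Reasoning

-- A tree S ∈ LT contained in `generated A r` has a stem extending A:
-- S branches immediately above its stem, and both branches extend A.
stem-extends : ∀ {S : Tree} (w : IsLT S) A r → S ⊆ generated A r → A ⊑ stem w
stem-extends {S} w A r S⊆ = ⊑-by-length (A⊑branch false) (⊑-++ X _) (⊑-fork X (A⊑ false) (A⊑ true) (λ ()))
  where
  X = stem w
  q = splitting w
  zs = initial (length A) (λ _ → false)
  y : Bool → Str
  y b = X ++ branch q (b ∷ zs)
  A⊑branch : ∀ b → A ⊑ y b
  A⊑branch b = generated-long (S⊆ (proj₂ (q-gen w) (generated-branch X q (b ∷ zs))))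
    (≤-trans (subst (_≤ length (b ∷ zs)) (initial-length (length A) _) (n≤1+n _))
      (≤-trans (branch-long (q-head w) (b ∷ zs)) (length-++-≥ X _)))
  A⊑ : ∀ b → A ⊑ (X ++ (b ∷ (proj₁ (q-head w 0 b) ++ branch (after 1 q) zs)))
  A⊑ b = subst (λ z → A ⊑ (X ++ (z ++ branch (after 1 q) zs))) (proj₂ (q-head w 0 b)) (A⊑branch b)

-- Cones of the same level are translates of each other, so (i) holds:
-- one cone of level n in ℙ puts all of them in ℙ.
cone-translate : ∀ {T} (w : IsLT T) n u u′ → length u ≡ n → length u′ ≡ n →
  (diff (stem w ++ branch (splitting w) u) (stem w ++ branch (splitting w) u′) ·T (T ⇒ u)) ≐ (T ⇒ u′)
cone-translate w n u u′ l l′ =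
  ≐-trans (·T-resp _ (cone w u n l))
  (≐-trans (translate-stem X X′ _ equal-length) (≐-sym (cone w u′ n l′)))
  where
  q = splitting w
  X = stem w ++ branch q u
  X′ = stem w ++ branch q u′
  equal-length : length X ≡ length X′
  equal-length = trans (length-++ (stem w))
    (trans (cong (length (stem w) +_) (branch-length {q} (q-len w) u u′ (trans l (sym l′))))
           (sym (length-++ (stem w))))

module Forcing {ℙ : Pred Tree 0ℓ} (F : IsLTForcing ℙ) where
  open IsLTForcing F

  ℙ-→₁ : ∀ T i → ℙ T → ℙ (T →₁ i)
  ℙ-→₁ T i pT = extens _ _ (≐-sym is-restriction) (restr T (X ++ [ i ]) X⌢i∈T pT)
    where
    w = ⊆LT T pT
    X = stem w
    is-restriction : (T →₁ i) ≐ (T ↾ (X ++ [ i ]))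
    is-restriction = (λ { (s , isS , x) → subst (λ z → (T ↾ (z ++ [ i ])) _) (stem-unique isS (lt-stem w)) x })
                   , (λ x → X , lt-stem w , x)
    X⌢i∈T : T (X ++ [ i ])
    X⌢i∈T = lt-down w (⊑-++ˡ X (split-head (q-head w) 0 i)) (proj₂ (q-gen w) ((λ _ → i) , 1 , ([] , ++-identityʳ _)))

  ℙ-⇒ : ∀ T u → ℙ T → ℙ (T ⇒ u)
  ℙ-⇒ T []      p = p
  ℙ-⇒ T (b ∷ u) p = ℙ-⇒ (T →₁ b) u (ℙ-→₁ T b p)

  -- A tree S ∈ ℙ contains, for every K, a generated subtree in ℙ whose stem
  -- has length at least K: the cone S(→ 0^K).
  high-subtree : ∀ S → ℙ S → ∀ K → Σ Str λ x → Σ (ℕ → Bool → Str) λ r →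
    Splitting r × Balanced r × (K ≤ length x) × (generated x r ⊆ S) × ℙ (generated x r)
  high-subtree S pS K =
    x , after K (splitting w) , (λ m → q-head w (K + m)) , (λ m → q-len w (K + m)) , K≤x
      , (λ v → ⇒-⊆ S 0ᴷ (proj₂ R≐ v)) , extens _ _ R≐ (ℙ-⇒ S 0ᴷ pS)
    where
    w = ⊆LT S pS
    0ᴷ = initial K (λ _ → false)
    x = stem w ++ branch (splitting w) 0ᴷ
    R≐ : (S ⇒ 0ᴷ) ≐ generated x (after K (splitting w))
    R≐ = cone w 0ᴷ K (initial-length K _)
    K≤x : K ≤ length x
    K≤x = ≤-trans (subst (_≤ length (branch (splitting w) 0ᴷ)) (initial-length K _) (branch-long (q-head w) 0ᴷ))
                  (length-++-≥ (stem w) _)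

  part-i : ∀ n T → IsLT T → ∀ s₀ → length s₀ ≡ n → ℙ (T ⇒ s₀) → LC n ℙ T
  part-i n T w s₀ l p = w , λ s ls → extens _ _ (cone-translate w n s₀ s l ls) (shift _ _ p)

graft : ℕ → (ℕ → Bool → Str) → (Bool → Str) → (ℕ → Bool → Str) → ℕ → Bool → Str
graft zero    q h r zero    = h
graft zero    q h r (suc k) = r k
graft (suc n) q h r zero    = q zero
graft (suc n) q h r (suc k) = graft n (after 1 q) h r k

graft-splitting : ∀ n {q h r} → Splitting q → (∀ i → Σ Str λ z → h i ≡ i ∷ z) → Splitting r →
                  Splitting (graft n q h r)
graft-splitting zero    hq hh hr zero    i = hh i
graft-splitting zero    hq hh hr (suc k) i = hr k i
graft-splitting (suc n) hq hh hr zero    i = hq zero i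
graft-splitting (suc n) hq hh hr (suc k) i = graft-splitting n (λ m → hq (suc m)) hh hr k i

graft-balanced : ∀ n {q h r} → Balanced q → length (h false) ≡ length (h true) → Balanced r →
                 Balanced (graft n q h r)
graft-balanced zero    lq lh lr zero    = lh
graft-balanced zero    lq lh lr (suc k) = lr k
graft-balanced (suc n) lq lh lr zero    = lq zero
graft-balanced (suc n) lq lh lr (suc k) = graft-balanced n (λ m → lq (suc m)) lh lr k

graft-below : ∀ n q h r j b → j < n → graft n q h r j b ≡ q j b
graft-below (suc n) q h r zero    b _       = refl
graft-below (suc n) q h r (suc j) b (s≤s l) = graft-below n (after 1 q) h r j b l

graft-above : ∀ n q h r k b → graft n q h r (suc n + k) b ≡ r k b
graft-above zero    q h r k b = refl
graft-above (suc n) q h r k b = graft-above n (after 1 q) h r k b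

branch-graft : ∀ u n q h r b → length u ≡ n → branch (graft n q h r) (u ++ [ b ]) ≡ branch q u ++ h b
branch-graft []      zero    q h r b refl = ++-identityʳ (h b)
branch-graft (a ∷ u) (suc n) q h r b e =
  trans (cong (q 0 a ++_) (branch-graft u n (after 1 q) h r b (suc-injective e))) (sym (++-assoc (q 0 a) _ _))

snoc-view : ∀ w n → length w ≡ suc n → Σ Str λ u → Σ Bool λ b → (w ≡ u ++ [ b ]) × (length u ≡ n)
snoc-view w n lw with initLast w
... | []       = ⊥-elim (0≢1+n lw)
... | u ∷ʳ′ b  = u , b , refl , suc-injective (trans (+-comm 1 (length u)) (trans (sym (length-++ u)) lw))

-- From P ∈ LT, a level n,
-- extension strings E_0, E_1 of equal length and a splitting sequence r we
-- build the tree Q with P's stem and splitting levels below n, level n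
-- replaced by q^n_b ⌢ E_b, and r above.  Its cones of level n+1 are the
-- trees generated by (stem of P(→ u⌢b)) ⌢ E_b and r; these are translates
-- of each other, so if for each b one of them ("an anchor") lies in ℙ and
-- inside the corresponding cone of P, then Q ∈ LC_{n+1}(ℙ) and Q ⊆_{n+1} P.
module Graft {ℙ : Pred Tree 0ℓ} (F : IsLTForcing ℙ) {P : Tree} (wP : IsLT P) (n : ℕ)
  (E : Bool → Str) (r : ℕ → Bool → Str) (hr : Splitting r) (lr : Balanced r)
  (lE : length (E false) ≡ length (E true)) where
  open IsLTForcing F

  private
    X = stem wP
    q = splitting wP
    h : Bool → Str
    h b = q n b ++ E b
    hq : Splitting (graft n q h r)
    hq = graft-splitting n (q-head wP)
           (λ i → proj₁ (q-head wP n i) ++ E i , cong (_++ E i) (proj₂ (q-head wP n i))) hr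
    lh : length (h false) ≡ length (h true)
    lh = trans (length-++ (q n false)) (trans (cong₂ _+_ (q-len wP n) lE) (sym (length-++ (q n true))))

  Q : Tree
  Q = generated X (graft n q h r)

  wQ : IsLT Q
  wQ = record { stem = X ; q = graft n q h r ; q-head = hq ; q-len = graft-balanced n (q-len wP) lh lr
              ; q-gen = (λ x → x) , (λ x → x) }

  P-cone : Str → Bool → Tree
  P-cone u b = generated (cone-stem wP n u b) (after (suc n) q)

  Q-cone : Str → Bool → Tree
  Q-cone u b = generated (cone-stem wP n u b ++ E b) r

  Q⇒ : ∀ u b → length u ≡ n → (Q ⇒ (u ++ [ b ])) ≐ Q-cone u b
  Q⇒ u b l = ≐-trans (⇒-generated hq (u ++ [ b ]) (suc n) length-u⌢b)
                     (generated-cong stem-u⌢b (λ k i → graft-above n q h r k i))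
    where
    length-u⌢b : length (u ++ [ b ]) ≡ suc n
    length-u⌢b = trans (length-++ u) (trans (+-comm (length u) 1) (cong suc l))
    stem-u⌢b : X ++ branch (graft n q h r) (u ++ [ b ]) ≡ cone-stem wP n u b ++ E b
    stem-u⌢b = begin
      X ++ branch (graft n q h r) (u ++ [ b ]) ≡⟨ cong (X ++_) (branch-graft u n q h r b l) ⟩
      X ++ (branch q u ++ (q n b ++ E b))     ≡⟨ cong (X ++_) (sym (++-assoc (branch q u) (q n b) (E b))) ⟩
      X ++ ((branch q u ++ q n b) ++ E b)     ≡⟨ sym (++-assoc X (branch q u ++ q n b) (E b)) ⟩
      cone-stem wP n u b ++ E b               ∎
      where open ≡-Reasoning

  Anchor : Bool → Set
  Anchor b = Σ Str λ u₀ → Σ Bool λ b₀ → (length u₀ ≡ n)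
             × (generated (cone-stem wP n u₀ b₀ ++ E b) r ⊆ P-cone u₀ b₀)
             × ℙ (generated (cone-stem wP n u₀ b₀ ++ E b) r)

  module Anchored (anchor : ∀ b → Anchor b) where

    private
      cone-⊆′ : ∀ u b → length u ≡ n → (Q ⇒ (u ++ [ b ])) ⊆ (P ⇒ (u ++ [ b ]))
      cone-⊆′ u b l x with anchor b
      ... | u₀ , b₀ , l₀ , ⊆P , _ =
        proj₂ (cone-snoc wP n u b l)
          (transport-⊆ (cone-stem wP n u₀ b₀) (cone-stem wP n u b) (E b) r (after (suc n) q)
             (cone-stem-length wP n u₀ b₀ u b l₀ l) ⊆P (proj₁ (Q⇒ u b l) x))

      ℙ-cone′ : ∀ u b → length u ≡ n → ℙ (Q ⇒ (u ++ [ b ]))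
      ℙ-cone′ u b l with anchor b
      ... | u₀ , b₀ , l₀ , _ , p =
        extens _ _ (≐-trans (translate-cone (cone-stem wP n u₀ b₀) (cone-stem wP n u b) (E b) r
                                            (cone-stem-length wP n u₀ b₀ u b l₀ l))
                            (≐-sym (Q⇒ u b l)))
               (shift _ _ p)

    cone-⊆ : ∀ w → length w ≡ suc n → (Q ⇒ w) ⊆ (P ⇒ w)
    cone-⊆ w lw with snoc-view w n lw
    ... | u , b , refl , l = cone-⊆′ u b l

    lc : LC (suc n) ℙ Q
    lc = wQ , ℙ-cone
      where
      ℙ-cone : ∀ w → length w ≡ suc n → ℙ (Q ⇒ w)
      ℙ-cone w lw with snoc-view w n lw
      ... | u , b , refl , l = ℙ-cone′ u b l

    subN : SubN (suc n) Q P
    subN = cover wQ (suc n) P (lt-down wP) (λ w l x → ⇒-⊆ P w (cone-⊆ w l x))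
         , λ wQ′ wP′ k k≤n → begin
             spl wQ′ k ≡⟨ spl-unique wQ′ wQ k ⟩
             spl wQ k  ≡⟨ spl-agree wQ wP refl k (λ j j<k → graft-below n q h r j false (<-≤-trans j<k (≤-pred k≤n))) ⟩
             spl wP k  ≡⟨ spl-unique wP wP′ k ⟩
             spl wP′ k ∎
      where open ≡-Reasoning

strings : ℕ → List Str
strings zero    = [] ∷ []
strings (suc n) = map (false ∷_) (strings n) ++ map (true ∷_) (strings n)

strings-length : ∀ n → All (λ u → length u ≡ n) (strings n)
strings-length zero    = refl ∷ []
strings-length (suc n) = ++⁺ (map⁺ longer) (map⁺ longer)
  where
  longer : All (λ u → suc (length u) ≡ suc n) (strings n)
  longer = All.map (cong suc) (strings-length n)

strings-complete : ∀ n u → length u ≡ n → u ∈ strings n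
strings-complete zero    []          refl = here refl
strings-complete (suc n) (false ∷ u) e = ∈-++⁺ˡ (∈-map⁺ (false ∷_) (strings-complete n u (suc-injective e)))
strings-complete (suc n) (true ∷ u)  e =
  ∈-++⁺ʳ (map (false ∷_) (strings n)) (∈-map⁺ (true ∷_) (strings-complete n u (suc-injective e)))

module Parts {ℙ : Pred Tree 0ℓ} (F : IsLTForcing ℙ) where
  open IsLTForcing F
  open Forcing F

  -- (ii), together with the fact that every level-n cone of Q lies in the
  -- corresponding cone of P (needed to iterate (ii) in (iii)).  For n = k+1
  -- the stem of S extends the stem A of the cone of P containing it, say by
  -- e, and we graft S's splitting strings onto P above A ⌢ e.
  part-ii : ∀ n P → LC n ℙ P → ∀ s₀ → length s₀ ≡ n → ∀ S → ℙ S → S ⊆ (P ⇒ s₀) →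
    Σ Tree λ Q → LC n ℙ Q × SubN n Q P × ((Q ⇒ s₀) ≐ S) × (∀ u → length u ≡ n → (Q ⇒ u) ⊆ (P ⇒ u))
  part-ii zero P lcP [] refl S pS S⊆ =
    S , (⊆LT S pS , λ { [] refl → pS }) , (S⊆ , λ _ _ k ()) , ((λ x → x) , (λ x → x)) , λ { [] refl → S⊆ }
  part-ii (suc n) P lcP s₀ l₀ S pS S⊆ with snoc-view s₀ n l₀
  ... | u₀ , b₀ , refl , l = G.Q , A.lc , A.subN , ≐-trans (G.Q⇒ u₀ b₀ l) S-generated , A.cone-⊆
    where
    wP = proj₁ lcP
    wS = ⊆LT S pS
    A = cone-stem wP n u₀ b₀
    S⊆cone : S ⊆ generated A (after (suc n) (splitting wP))
    S⊆cone x = proj₁ (cone-snoc wP n u₀ b₀ l) (S⊆ x)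
    e = proj₁ (stem-extends wS A _ S⊆cone)
    S-generated : generated (A ++ e) (splitting wS) ≐ S
    S-generated = ≐-trans (generated-stem-cong (proj₂ (stem-extends wS A _ S⊆cone))) (≐-sym (q-gen wS))
    module G = Graft F wP n (λ _ → e) (splitting wS) (q-head wS) (q-len wS) refl
    anchor : ∀ b → G.Anchor b
    anchor b = u₀ , b₀ , l , (λ x → S⊆cone (proj₁ S-generated x)) , extens _ _ (≐-sym S-generated) pS
    module A = G.Anchored anchor

  -- (iii) for the cones indexed by a list L: apply density below one cone
  -- at a time and shrink it with (ii); the other cones only shrink, so by
  -- openness they stay in D.
  part-iii-list : ∀ n P → LC n ℙ P → ∀ D → OpenDense ℙ D → ∀ L → All (λ u → length u ≡ n) L →
    Σ Tree λ Q → LC n ℙ Q × SubN n Q P × All (λ u → D (Q ⇒ u)) L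
  part-iii-list n P lcP D od [] [] = P , lcP , ((λ x → x) , λ w w′ k _ → spl-unique w w′ k) , []
  part-iii-list n P lcP D od (u ∷ L) (lu ∷ lL) with part-iii-list n P lcP D od L lL
  ... | Q , lcQ , Q⊆P , inD with OpenDense.dense od (Q ⇒ u) (proj₂ lcQ u lu)
  ...   | S , S∈D , S⊆ with part-ii n Q lcQ u lu S (OpenDense.D⊆ℙ od S S∈D) S⊆
  ...     | Q′ , lcQ′ , Q′⊆Q , Q′⇒u≐S , cones⊆ =
    Q′ , lcQ′ , SubN-trans Q′⊆Q (proj₁ lcQ) Q⊆P ,
    open′ _ _ (proj₂ lcQ′ u lu) (proj₁ Q′⇒u≐S) S∈D ∷ All.zipWith (λ {v} → still-in-D {v}) (lL , inD)
    where
    open OpenDense od using (open′)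
    still-in-D : ∀ {v} → length v ≡ n × D (Q ⇒ v) → D (Q′ ⇒ v)
    still-in-D {v} (lv , d) = open′ _ _ (proj₂ lcQ′ v lv) (cones⊆ v lv) d

  part-iii : ∀ n P → LC n ℙ P → ∀ D → OpenDense ℙ D →
    Σ Tree λ Q → LC n ℙ Q × SubN n Q P × (∀ s → length s ≡ n → D (Q ⇒ s))
  part-iii n P lcP D od with part-iii-list n P lcP D od (strings n) (strings-length n)
  ... | Q , lcQ , Q⊆P , inD = Q , lcQ , Q⊆P , λ s ls → All.lookup inD (strings-complete n s ls)

  -- Let A₀, A₁ be the stems of the cones P(→ s⌢0), P(→ t⌢1), of
  -- equal length.  Take a subtree R = generated x r ∈ ℙ of S with
  -- lh x ≥ lh σ + lh A₀; then x = A₀ ⌢ f and σ·x = A₁ ⌢ g with lh f = lh g.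
  -- Graft with E_0 = f, E_1 = g and r: the anchors are R ⊆ S at s⌢0 and its
  -- translate σ·R ⊆ T at t⌢1.
  part-iv : ∀ n P → LC n ℙ P → ∀ S T → ℙ S → ℙ T → ∀ s t → length s ≡ n → length t ≡ n →
       S ⊆ (P ⇒ (s ++ [ false ])) → T ⊆ (P ⇒ (t ++ [ true ])) →
       ∀ σ → T ≐ (σ ·T S) →
       Σ Tree λ Q → LC (suc n) ℙ Q × SubN (suc n) Q P
         × ((Q ⇒ (s ++ [ false ])) ⊆ S) × ((Q ⇒ (t ++ [ true ])) ⊆ T)
  part-iv n P lcP S T pS pT s t ls lt S⊆ T⊆ σ T≐σS
    with high-subtree S pS (length σ + length (cone-stem (proj₁ lcP) n s false))
  ... | x , r , hr , lr , long , R⊆S , R∈ℙ =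
    G.Q , A.lc , A.subN , (λ v → R⊆S (proj₁ R₀ (proj₁ (G.Q⇒ s false ls) v)))
                        , (λ v → σR⊆T (proj₁ R₁ (proj₁ (G.Q⇒ t true lt) v)))
    where
    wP = proj₁ lcP
    A₀ = cone-stem wP n s false
    A₁ = cone-stem wP n t true
    |A₀|≡|A₁| : length A₀ ≡ length A₁
    |A₀|≡|A₁| = cone-stem-length wP n s false t true ls lt
    R = generated x r
    σR⊆T : (σ ·T R) ⊆ T
    σR⊆T v = proj₂ T≐σS (·T-mono σ R⊆S v)
    A₀≤x : length A₀ ≤ length x
    A₀≤x = ≤-trans (m≤n+m _ (length σ)) long
    A₀⊑x : A₀ ⊑ x
    A₀⊑x = generated-long (proj₁ (cone-snoc wP n s false ls) (S⊆ (R⊆S generated-root))) A₀≤x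
    A₁⊑σx : A₁ ⊑ (σ · x)
    A₁⊑σx = generated-long (proj₁ (cone-snoc wP n t true lt) (T⊆ (σR⊆T (x , generated-root , refl))))
      (subst (length A₁ ≤_) (sym (·-length σ x)) (subst (_≤ length x) |A₀|≡|A₁| A₀≤x))
    f = proj₁ A₀⊑x
    g = proj₁ A₁⊑σx
    E : Bool → Str
    E false = f
    E true  = g
    R₀ : generated (A₀ ++ f) r ≐ R
    R₀ = generated-stem-cong (proj₂ A₀⊑x)
    R₁ : generated (A₁ ++ g) r ≐ (σ ·T R)
    R₁ = ≐-trans (generated-stem-cong (proj₂ A₁⊑σx)) (≐-sym (translate-generated σ x r (≤-trans (m≤m+n _ _) long)))
    module G = Graft F wP n E r hr lr
      (extension-length A₀ A₁ f g |A₀|≡|A₁| (trans (cong length (proj₂ A₀⊑x))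
                                   (trans (sym (·-length σ x)) (cong length (sym (proj₂ A₁⊑σx))))))
    anchor : ∀ b → G.Anchor b
    anchor false = s , false , ls
      , (λ v → proj₁ (cone-snoc wP n s false ls) (S⊆ (R⊆S (proj₁ R₀ v))))
      , extens _ _ (≐-sym R₀) R∈ℙ
    anchor true = t , true , lt
      , (λ v → proj₁ (cone-snoc wP n t true lt) (T⊆ (σR⊆T (proj₁ R₁ v))))
      , extens _ _ (≐-sym R₁) (shift _ σ R∈ℙ)
    module A = G.Anchored anchor

lemma4p1 : (ℙ : Pred Tree 0ℓ) → IsLTForcing ℙ → (n : ℕ) →
    -- (i)
    (∀ T → IsLT T → ∀ s₀ → length s₀ ≡ n →
       (ℙ (T ⇒ s₀) → LC n ℙ T) × (LC n ℙ T → ℙ (T ⇒ s₀)))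
    -- (ii)
    × (∀ P → LC n ℙ P → ∀ s₀ → length s₀ ≡ n → ∀ S → ℙ S → S ⊆ (P ⇒ s₀) →
       Σ Tree λ Q → LC n ℙ Q × SubN n Q P × ((Q ⇒ s₀) ≐ S))
    -- (iii)
    × (∀ P → LC n ℙ P → ∀ D → OpenDense ℙ D →
       Σ Tree λ Q → LC n ℙ Q × SubN n Q P × (∀ s → length s ≡ n → D (Q ⇒ s)))
    -- (iv)
    × (∀ P → LC n ℙ P → ∀ S T → ℙ S → ℙ T → ∀ s t → length s ≡ n → length t ≡ n →
       S ⊆ (P ⇒ (s ++ [ false ])) → T ⊆ (P ⇒ (t ++ [ true ])) →
       ∀ σ → T ≐ (σ ·T S) →
       Σ Tree λ Q → LC (suc n) ℙ Q × SubN (suc n) Q P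
         × ((Q ⇒ (s ++ [ false ])) ⊆ S) × ((Q ⇒ (t ++ [ true ])) ⊆ T))
lemma4p1 ℙ F n =
    (λ T w s₀ l → part-i n T w s₀ l , (λ lcT → proj₂ lcT s₀ l))
  , (λ P lcP s₀ l S pS S⊆ → let (Q , lcQ , Q⊆P , Q⇒s₀≐S , _) = part-ii n P lcP s₀ l S pS S⊆
                             in Q , lcQ , Q⊆P , Q⇒s₀≐S)
  , part-iii n
  , part-iv n
  where
  open Forcing F using (part-i)
  open Parts F using (part-ii; part-iii; part-iv)
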